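{- Let $n\ge 3$ be an integer and let $$S^3(n)=\{(x,y,z)\in\mathbb{N}^3:\ 0\le x<y<z\le n\}.$$ Then for every integer $l$ with $2\le l\le n-1$, the number of $l$-element subsets of $S^3(n)$ whose points have pairwise distinct $y$-coordinates is strictly greater than the number of $l$-element subsets of $S^3(n)$ whose points have pairwise distinct $x$-coordinates.
   Context: $\mathbb{N}$ denotes the nonnegative integers. -}

module Defs where

open import Data.Nat using (ℕ; zero; suc; _≟_)
open import Data.Product using (_×_; _,_)
open import Data.List using (List; []; _∷_; map; concatMap; upTo; length; filter; _++_)
open import Data.List.Relation.Unary.AllPairs using (AllPairs; allPairs?)
open import Relation.Binary.PropositionalEquality using (_≢_)
open import Relation.Nullary.Decidable using (¬?)

Point : Set
Point = ℕ × ℕ × ℕ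

xc yc : Point → ℕ
xc (x , _ , _) = x
yc (_ , y , _) = y

-- S³(n) = {(x,y,z) ∈ ℕ³ : 0 ≤ x < y < z ≤ n}, enumerated without repetition
S3 : ℕ → List Point
S3 n = concatMap (λ z → concatMap (λ y → map (λ x → (x , y , z)) (upTo y)) (upTo z))
                 (upTo (suc n))

-- all sublists (subsequences) of a list; for a duplicate-free list these
-- correspond bijectively to its subsets
sublists : {A : Set} → List A → List (List A)
sublists [] = [] ∷ []
sublists (a ∷ as) = map (a ∷_) (sublists as) ++ sublists as

subsetsOfSize : ℕ → ℕ → List (List Point)
subsetsOfSize n l = filter (λ s → length s ≟ l) (sublists (S3 n))

countDistinct : (Point → ℕ) → ℕ → ℕ → ℕ
countDistinct f n l =
  length (filter (allPairs? (λ p q → ¬? (f p ≟ f q))) (subsetsOfSize n l))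

-- Grouping the points of S³(n) by one coordinate, a set whose points have pairwise distinct
-- values of that coordinate takes at most one point from each group, so both counts are the
-- elementary symmetric function e_l of the group sizes: C(n − a, 2) points have x = a and
-- b (n − b) points have y = b.  From n to n + 1 the x-sizes get C(n + 1, 2) prepended, while
-- the y-sizes arise from C(n + 1, 2) followed by the old y-sizes by handing out
-- C(n + 1, 2) = 1 + ⋯ + n, the amount b going to the size for y = b.  Each single hand-out
-- keeps the sum of the two entries involved and does not decrease their product, hence
-- decreases no e_l; so by induction on n the x-sizes are dominated by the y-sizes, and in the
-- last step one hand-out increases e_l strictly when 2 ≤ l ≤ n − 1.
module Submission where

open import Defs
open import Data.Nat using (ℕ; zero; suc; _+_; _*_; _∸_; _≤_; _<_; z≤n; s≤s; >-nonZero)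
open import Data.Nat.Properties
open import Data.Nat.ListAction using (sum)
open import Data.Nat.ListAction.Properties using (sum-++)
open import Data.Nat.Tactic.RingSolver using (solve-∀)
open import Data.List using (List; []; _∷_; _++_; [_]; _∷ʳ_; applyUpTo; upTo; map; concatMap; filter; length)
open import Data.List.Properties
  using (applyUpTo-∷ʳ; upTo-∷ʳ; concatMap-++; ++-identityʳ; length-++; length-map; length-applyUpTo;
         filter-++; filter-≐; filter-all; filter-none; filter-accept; filter-reject)
open import Data.List.Relation.Unary.All as All using (All; _∷_; all?)
open import Data.List.Relation.Unary.All.Properties using (filter⁺; applyUpTo⁺₁; concat⁺; map⁺)
open import Data.List.Relation.Unary.AllPairs using (AllPairs; allPairs?; _∷_)
open import Data.List.Relation.Binary.Permutation.Propositional
  using (_↭_; prep; swap; ↭-reflexive) renaming (refl to ↭-refl; trans to ↭-trans)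
open import Data.List.Relation.Binary.Permutation.Propositional.Properties using (shift; ∷↭∷ʳ)
open import Data.Product using (_×_; _,_; proj₂) renaming (swap to ×-swap)
open import Function using (_∘_; id)
open import Level using (0ℓ)
open import Relation.Nullary using (¬_; Dec; yes; no)
open import Relation.Nullary.Decidable using (¬?)
open import Relation.Unary using (Pred; Decidable)
open import Relation.Unary.Properties using (_∩?_)
open import Relation.Binary.PropositionalEquality
  using (_≡_; _≢_; refl; sym; trans; cong; cong₂; subst; module ≡-Reasoning)

esym : List ℕ → ℕ → ℕ
esym _        zero    = 1
esym []       (suc l) = 0
esym (x ∷ xs) (suc l) = x * esym xs l + esym xs (suc l)

esym-0∷ : ∀ xs l → esym (0 ∷ xs) l ≡ esym xs l
esym-0∷ xs zero    = refl
esym-0∷ xs (suc l) = refl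

esym-suc∷ : ∀ x xs l → esym (suc x ∷ xs) (suc l) ≡ esym (x ∷ xs) (suc l) + esym xs l
esym-suc∷ x xs l = lemma (esym xs l) (x * esym xs l) (esym xs (suc l))
  where
  lemma : ∀ a b c → a + b + c ≡ b + c + a
  lemma = solve-∀

esym-∷∷-1 : ∀ x y xs → esym (x ∷ y ∷ xs) 1 ≡ x + y + esym xs 1
esym-∷∷-1 x y xs = lemma x y (esym xs 1)
  where
  lemma : ∀ x y a → x * 1 + (y * 1 + a) ≡ x + y + a
  lemma = solve-∀

esym-∷∷ : ∀ x y xs l →
  esym (x ∷ y ∷ xs) (suc (suc l)) ≡ x * y * esym xs l + (x + y) * esym xs (suc l) + esym xs (suc (suc l))
esym-∷∷ x y xs l = lemma x y (esym xs l) (esym xs (suc l)) (esym xs (suc (suc l)))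
  where
  lemma : ∀ x y a b c → x * (y * a + b) + (y * b + c) ≡ x * y * a + (x + y) * b + c
  lemma = solve-∀

esym-swap : ∀ x y xs l → esym (x ∷ y ∷ xs) l ≡ esym (y ∷ x ∷ xs) l
esym-swap x y xs zero = refl
esym-swap x y xs (suc zero) rewrite esym-∷∷-1 x y xs | esym-∷∷-1 y x xs | +-comm x y = refl
esym-swap x y xs (suc (suc l)) rewrite esym-∷∷ x y xs l | esym-∷∷ y x xs l | *-comm x y | +-comm x y = refl

esym-∷-cong : ∀ x {xs ys} → (∀ l → esym xs l ≡ esym ys l) → ∀ l → esym (x ∷ xs) l ≡ esym (x ∷ ys) l
esym-∷-cong x eq zero    = refl
esym-∷-cong x eq (suc l) = cong₂ (λ a b → x * a + b) (eq l) (eq (suc l))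

esym-↭ : ∀ {xs ys} → xs ↭ ys → ∀ l → esym xs l ≡ esym ys l
esym-↭ ↭-refl        l = refl
esym-↭ (prep x p)    l = esym-∷-cong x (esym-↭ p) l
esym-↭ (swap x y p)  l = trans (esym-swap x y _ l) (esym-∷-cong y (esym-∷-cong x (esym-↭ p)) l)
esym-↭ (↭-trans p q) l = trans (esym-↭ p l) (esym-↭ q l)

esym-zeros : ∀ B l → esym (applyUpTo (λ _ → 0) B) (suc l) ≡ 0
esym-zeros zero    l = refl
esym-zeros (suc B) l = esym-zeros B l

esym-applyUpTo-pos : ∀ g B j → j ≤ B → (∀ i → i < j → 0 < g i) → 0 < esym (applyUpTo g B) j
esym-applyUpTo-pos g B       zero    _         _   = s≤s z≤n
esym-applyUpTo-pos g (suc B) (suc j) (s≤s j≤B) pos =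
  ≤-trans (*-mono-≤ (pos 0 (s≤s z≤n))
                    (esym-applyUpTo-pos (g ∘ suc) B j j≤B (λ i i<j → pos (suc i) (s≤s i<j))))
          (m≤m+n _ _)

applyUpTo-cong : ∀ {A : Set} {f g : ℕ → A} n → (∀ i → i < n → f i ≡ g i) →
  applyUpTo f n ≡ applyUpTo g n
applyUpTo-cong zero    eq = refl
applyUpTo-cong (suc n) eq =
  cong₂ _∷_ (eq 0 (s≤s z≤n)) (applyUpTo-cong n (λ i i<n → eq (suc i) (s≤s i<n)))

applyUpTo-split : ∀ {A : Set} (g : ℕ → A) v k →
  applyUpTo g (suc v + k) ≡ applyUpTo g v ++ g v ∷ applyUpTo (λ i → g (suc v + i)) k
applyUpTo-split g zero    k = refl
applyUpTo-split g (suc v) k = cong (g 0 ∷_) (applyUpTo-split (g ∘ suc) v k)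

esym-applyUpTo-focus : ∀ (g h : ℕ → ℕ) v k → (∀ i → i ≢ v → g i ≡ h i) → ∀ l →
  esym (applyUpTo g (suc v + k)) l ≡ esym (g v ∷ applyUpTo h v ++ applyUpTo (λ i → h (suc v + i)) k) l
esym-applyUpTo-focus g h v k g≡h l = trans
  (esym-↭ (↭-trans (↭-reflexive (applyUpTo-split g v k)) (shift (g v) (applyUpTo g v) _)) l)
  (cong (λ xs → esym (g v ∷ xs) l) (cong₂ _++_
    (applyUpTo-cong v (λ i i<v → g≡h i (<⇒≢ i<v)))
    (applyUpTo-cong k (λ i _ → g≡h (suc v + i) (λ eq → <⇒≢ (m≤m+n (suc v) i) (sym eq))))))

esym-applyUpTo-increment : ∀ (c c⁺ c₀ : ℕ → ℕ) {v B} → v < B →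
  c⁺ v ≡ suc (c v) → (∀ i → i ≢ v → c⁺ i ≡ c i) → c₀ v ≡ 0 → (∀ i → i ≢ v → c₀ i ≡ c i) → ∀ l →
  esym (applyUpTo c⁺ B) (suc l) ≡ esym (applyUpTo c₀ B) l + esym (applyUpTo c B) (suc l)
esym-applyUpTo-increment c c⁺ c₀ {v} v<B c⁺v c⁺≡c c₀v c₀≡c l with m≤n⇒∃[o]m+o≡n v<B
... | k , refl = begin
  esym (applyUpTo c⁺ (suc v + k)) (suc l)     ≡⟨ esym-applyUpTo-focus c⁺ c v k c⁺≡c (suc l) ⟩
  esym (c⁺ v ∷ others) (suc l)                ≡⟨ cong (λ x → esym (x ∷ others) (suc l)) c⁺v ⟩
  esym (suc (c v) ∷ others) (suc l)           ≡⟨ esym-suc∷ (c v) others l ⟩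
  esym (c v ∷ others) (suc l) + esym others l ≡⟨ +-comm _ (esym others l) ⟩
  esym others l + rest                        ≡⟨ cong (_+ rest) (esym-0∷ others l) ⟨
  esym (0 ∷ others) l + rest                  ≡⟨ cong (λ x → esym (x ∷ others) l + rest) c₀v ⟨
  esym (c₀ v ∷ others) l + rest
    ≡⟨ cong₂ _+_ (esym-applyUpTo-focus c₀ c v k c₀≡c l)
                 (esym-applyUpTo-focus c c v k (λ _ _ → refl) (suc l)) ⟨
  esym (applyUpTo c₀ (suc v + k)) l + esym (applyUpTo c (suc v + k)) (suc l) ∎
  where
  open ≡-Reasoning
  others = applyUpTo c v ++ applyUpTo (λ i → c (suc v + i)) k
  rest = esym (c v ∷ others) (suc l)

record _≼_ (xs ys : List ℕ) : Set where
  constructor dominated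
  field esym-≤ : ∀ l → esym xs l ≤ esym ys l
open _≼_

≼-trans : ∀ {xs ys zs} → xs ≼ ys → ys ≼ zs → xs ≼ zs
≼-trans p q = dominated λ l → ≤-trans (esym-≤ p l) (esym-≤ q l)

↭⇒≼ : ∀ {xs ys} → xs ↭ ys → xs ≼ ys
↭⇒≼ p = dominated λ l → ≤-reflexive (esym-↭ p l)

∷-mono-≼ : ∀ x {xs ys} → xs ≼ ys → (x ∷ xs) ≼ (x ∷ ys)
∷-mono-≼ x {xs} {ys} p = dominated mono
  where
  mono : ∀ l → esym (x ∷ xs) l ≤ esym (x ∷ ys) l
  mono zero    = ≤-refl
  mono (suc l) = +-mono-≤ (*-monoʳ-≤ x (esym-≤ p l)) (esym-≤ p (suc l))

insert₂-≼ : ∀ x {a b xs ys} → (a ∷ xs) ≼ (b ∷ ys) → (a ∷ x ∷ xs) ≼ (b ∷ x ∷ ys)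
insert₂-≼ x p = ≼-trans (↭⇒≼ (swap _ x ↭-refl)) (≼-trans (∷-mono-≼ x p) (↭⇒≼ (swap x _ ↭-refl)))

transfer-≼ : ∀ p q p′ q′ xs → p + q ≡ p′ + q′ → p * q ≤ p′ * q′ → (p ∷ q ∷ xs) ≼ (p′ ∷ q′ ∷ xs)
transfer-≼ p q p′ q′ xs sum≡ prod≤ = dominated mono
  where
  mono : ∀ l → esym (p ∷ q ∷ xs) l ≤ esym (p′ ∷ q′ ∷ xs) l
  mono zero = ≤-refl
  mono (suc zero) rewrite esym-∷∷-1 p q xs | esym-∷∷-1 p′ q′ xs | sum≡ = ≤-refl
  mono (suc (suc l)) rewrite esym-∷∷ p q xs l | esym-∷∷ p′ q′ xs l | sum≡ =
    +-monoˡ-≤ _ (+-monoˡ-≤ _ (*-monoˡ-≤ (esym xs l) prod≤))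

transfer-< : ∀ p q p′ q′ xs l → p + q ≡ p′ + q′ → p * q < p′ * q′ → 0 < esym xs l →
  esym (p ∷ q ∷ xs) (suc (suc l)) < esym (p′ ∷ q′ ∷ xs) (suc (suc l))
transfer-< p q p′ q′ xs l sum≡ prod< pos rewrite esym-∷∷ p q xs l | esym-∷∷ p′ q′ xs l | sum≡ =
  +-monoˡ-< _ (+-monoˡ-< _ (*-monoˡ-< (esym xs l) {{>-nonZero pos}} prod<))

-- In (sum d ∷ q) the first entry hands d i to q i, for i = 0, 1, …; the hand-out to q i is a
-- transfer from the donor, which then holds the sum of the d j with j > i, and keeps the
-- product from decreasing exactly when q i is at most that sum.
Donatable : (q d : ℕ → ℕ) → ℕ → Set
Donatable q d B = ∀ i → i < B → q i ≤ sum (applyUpTo (λ j → d (suc i + j)) (B ∸ suc i))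

*≤sum-applyUpTo : ∀ {c} f k → (∀ j → c ≤ f j) → k * c ≤ sum (applyUpTo f k)
*≤sum-applyUpTo f zero    c≤f = z≤n
*≤sum-applyUpTo f (suc k) c≤f = +-mono-≤ (c≤f 0) (*≤sum-applyUpTo (f ∘ suc) k (c≤f ∘ suc))

donation-sum : ∀ d s q → d + s + q ≡ s + (q + d)
donation-sum = solve-∀

donation-product-expandˡ : ∀ d s q → (d + s) * q ≡ s * q + d * q
donation-product-expandˡ = solve-∀

donation-product-expandʳ : ∀ d s q → s * q + d * s ≡ s * (q + d)
donation-product-expandʳ = solve-∀

donation-product-≤ : ∀ d {s q} → q ≤ s → (d + s) * q ≤ s * (q + d)
donation-product-≤ d {s} {q} q≤s = begin
  (d + s) * q   ≡⟨ donation-product-expandˡ d s q ⟩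
  s * q + d * q ≤⟨ +-monoʳ-≤ (s * q) (*-monoʳ-≤ d q≤s) ⟩
  s * q + d * s ≡⟨ donation-product-expandʳ d s q ⟩
  s * (q + d)   ∎
  where open ≤-Reasoning

donation-product-< : ∀ d {s q} → 0 < d → q < s → (d + s) * q < s * (q + d)
donation-product-< d {s} {q} 0<d q<s = begin-strict
  (d + s) * q   ≡⟨ donation-product-expandˡ d s q ⟩
  s * q + d * q <⟨ +-monoʳ-< (s * q) (*-monoʳ-< d {{>-nonZero 0<d}} q<s) ⟩
  s * q + d * s ≡⟨ donation-product-expandʳ d s q ⟩
  s * (q + d)   ∎
  where open ≤-Reasoning

module _ (B : ℕ) (q d : ℕ → ℕ) where
  private
    S′ = sum (applyUpTo (d ∘ suc) B)
    rest = applyUpTo (q ∘ suc) B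

  first-donation-≼ : q 0 ≤ S′ → (d 0 + S′ ∷ q 0 ∷ rest) ≼ (S′ ∷ q 0 + d 0 ∷ rest)
  first-donation-≼ q₀≤S′ =
    transfer-≼ (d 0 + S′) (q 0) S′ (q 0 + d 0) rest
      (donation-sum (d 0) S′ (q 0)) (donation-product-≤ (d 0) q₀≤S′)

  first-donation-< : ∀ l → q 0 < S′ → 0 < d 0 → 0 < esym rest l →
    esym (d 0 + S′ ∷ q 0 ∷ rest) (suc (suc l)) < esym (S′ ∷ q 0 + d 0 ∷ rest) (suc (suc l))
  first-donation-< l q₀<S′ 0<d₀ = transfer-< (d 0 + S′) (q 0) S′ (q 0 + d 0) rest l
    (donation-sum (d 0) S′ (q 0)) (donation-product-< (d 0) 0<d₀ q₀<S′)

donate-≼ : ∀ B q d → Donatable q d B →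
  (sum (applyUpTo d B) ∷ applyUpTo q B) ≼ (0 ∷ applyUpTo (λ i → q i + d i) B)
donate-≼ zero    q d _   = ↭⇒≼ ↭-refl
donate-≼ (suc B) q d don = ≼-trans (first-donation-≼ B q d (don 0 (s≤s z≤n)))
  (insert₂-≼ (q 0 + d 0) (donate-≼ B (q ∘ suc) (d ∘ suc) (λ i i<B → don (suc i) (s≤s i<B))))

donate-< : ∀ B q d l → Donatable q d (suc B) → q 0 < sum (applyUpTo (d ∘ suc) B) → 0 < d 0 →
  0 < esym (applyUpTo (q ∘ suc) B) l →
  esym (sum (applyUpTo d (suc B)) ∷ applyUpTo q (suc B)) (suc (suc l))
    < esym (0 ∷ applyUpTo (λ i → q i + d i) (suc B)) (suc (suc l))
donate-< B q d l don q₀<S′ 0<d₀ pos = <-≤-trans (first-donation-< B q d l q₀<S′ 0<d₀ pos)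
  (esym-≤ (insert₂-≼ (q 0 + d 0) (donate-≼ B (q ∘ suc) (d ∘ suc) (λ i i<B → don (suc i) (s≤s i<B))))
          (suc (suc l)))

triangle : ℕ → ℕ
triangle k = sum (upTo k)

triangle-suc : ∀ k → triangle (suc k) ≡ triangle k + k
triangle-suc k = begin
  sum (upTo (suc k))      ≡⟨ cong sum (upTo-∷ʳ k) ⟨
  sum (upTo k ++ [ k ])   ≡⟨ sum-++ (upTo k) [ k ] ⟩
  triangle k + (k + 0)    ≡⟨ cong (triangle k +_) (+-identityʳ k) ⟩
  triangle k + k          ∎
  where open ≡-Reasoning

xCount yCount : ℕ → ℕ → ℕ
xCount n a = triangle (n ∸ a)
yCount n b = b * (n ∸ b)

xCounts yCounts : ℕ → List ℕ
xCounts n = applyUpTo (xCount n) (suc n)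
yCounts n = applyUpTo (yCount n) (suc n)

yCount-suc : ∀ m i → i < m → yCount m (suc i) + suc i ≡ yCount (suc m) (suc i)
yCount-suc (suc m) i (s≤s i≤m) rewrite +-∸-assoc 1 i≤m =
  trans (+-comm _ (suc i)) (sym (*-suc (suc i) (m ∸ i)))

yCounts-donatable : ∀ m → Donatable (yCount m ∘ suc) suc m
yCounts-donatable m i _ = begin
  suc i * (m ∸ suc i)
    ≡⟨ *-comm (suc i) (m ∸ suc i) ⟩
  (m ∸ suc i) * suc i
    ≤⟨ *≤sum-applyUpTo _ (m ∸ suc i) (λ j → m≤n⇒m≤1+n (m≤m+n (suc i) j)) ⟩
  sum (applyUpTo (λ j → suc (suc i + j)) (m ∸ suc i)) ∎
  where open ≤-Reasoning

yCounts-after-donation : ∀ m →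
  (0 ∷ 0 ∷ applyUpTo (λ i → yCount m (suc i) + suc i) m) ↭ yCounts (suc m)
yCounts-after-donation m = prep 0 (subst (0 ∷ donated ↭_) last-zero (∷↭∷ʳ 0 donated))
  where
  open ≡-Reasoning
  donated = applyUpTo (λ i → yCount m (suc i) + suc i) m
  last-zero : donated ∷ʳ 0 ≡ applyUpTo (yCount (suc m) ∘ suc) (suc m)
  last-zero = begin
    donated ∷ʳ 0
      ≡⟨ cong₂ _∷ʳ_ (applyUpTo-cong m (yCount-suc m))
                    (sym (trans (cong (suc m *_) (n∸n≡0 m)) (*-zeroʳ (suc m)))) ⟩
    applyUpTo (yCount (suc m) ∘ suc) m ∷ʳ yCount (suc m) (suc m)
      ≡⟨ applyUpTo-∷ʳ (yCount (suc m) ∘ suc) m ⟩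
    applyUpTo (yCount (suc m) ∘ suc) (suc m) ∎

-- xCounts (suc m) is definitionally triangle (suc m) ∷ xCounts m, whereas the new layer
-- z = m + 1 adds b points with y = b to yCounts m.
yCounts-step : ∀ m → (triangle (suc m) ∷ yCounts m) ≼ yCounts (suc m)
yCounts-step m = ≼-trans (insert₂-≼ 0 (donate-≼ m (yCount m ∘ suc) suc (yCounts-donatable m)))
                         (↭⇒≼ (yCounts-after-donation m))

-- The hand-out to the entry for y = 1 is strict: that entry is m − 1 < 2 + ⋯ + m, and e_l of
-- the entries for y = 2, …, m − 1 is positive.
yCounts-step-< : ∀ k l → l ≤ k →
  esym (triangle (3 + k) ∷ yCounts (2 + k)) (2 + l) < esym (yCounts (3 + k)) (2 + l)
yCounts-step-< k l l≤k = begin-strict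
  esym (triangle (suc m) ∷ 0 ∷ applyUpTo q m) (2 + l)
    ≡⟨ esym-swap (triangle (suc m)) 0 (applyUpTo q m) (2 + l) ⟩
  esym (triangle (suc m) ∷ applyUpTo q m) (2 + l)
    <⟨ donate-< (suc k) q suc l (yCounts-donatable m) q₀<S′ (s≤s z≤n) rest-pos ⟩
  esym (0 ∷ 0 ∷ applyUpTo (λ i → q i + suc i) m) (2 + l)
    ≡⟨ esym-↭ (yCounts-after-donation m) (2 + l) ⟩
  esym (yCounts (suc m)) (2 + l) ∎
  where
  open ≤-Reasoning
  m = 2 + k
  q = yCount m ∘ suc
  q₀<S′ : q 0 < sum (applyUpTo (λ j → suc (suc j)) (suc k))
  q₀<S′ = ≤-<-trans (≤-reflexive (*-identityˡ (suc k)))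
    (<-≤-trans (m<m*n (suc k) 2 (s≤s (s≤s z≤n)))
               (*≤sum-applyUpTo (λ j → suc (suc j)) (suc k) (λ _ → s≤s (s≤s z≤n))))
  rest-pos : 0 < esym (applyUpTo (q ∘ suc) (suc k)) l
  rest-pos = esym-applyUpTo-pos (q ∘ suc) (suc k) l (m≤n⇒m≤1+n l≤k)
    (λ i i<l → *-mono-≤ {1} {2 + i} (s≤s z≤n) (m<n⇒0<n∸m (<-≤-trans i<l l≤k)))

xCounts≼yCounts : ∀ m → xCounts m ≼ yCounts m
xCounts≼yCounts zero    = ↭⇒≼ ↭-refl
xCounts≼yCounts (suc m) = ≼-trans (∷-mono-≼ (triangle (suc m)) (xCounts≼yCounts m)) (yCounts-step m)

esym-xCounts<esym-yCounts : ∀ k l → l ≤ k →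
  esym (xCounts (3 + k)) (2 + l) < esym (yCounts (3 + k)) (2 + l)
esym-xCounts<esym-yCounts k l l≤k =
  ≤-<-trans (esym-≤ (∷-mono-≼ (triangle (3 + k)) (xCounts≼yCounts (2 + k))) (2 + l))
            (yCounts-step-< k l l≤k)

module _ {A B : Set} {P : Pred B 0ℓ} (P? : Decidable P) where

  filter-map : (g : A → B) → ∀ xs → filter P? (map g xs) ≡ map g (filter (P? ∘ g) xs)
  filter-map g []       = refl
  filter-map g (x ∷ xs) with P? (g x)
  ... | yes _ = cong (g x ∷_) (filter-map g xs)
  ... | no  _ = filter-map g xs

module _ {A : Set} {P Q : Pred A 0ℓ} (P? : Decidable P) (Q? : Decidable Q) where

  filter-filter : ∀ xs → filter P? (filter Q? xs) ≡ filter (Q? ∩? P?) xs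
  filter-filter []       = refl
  filter-filter (x ∷ xs) with Q? x
  ... | no  _ = filter-filter xs
  ... | yes _ with P? x
  ...   | yes _ = cong (x ∷_) (filter-filter xs)
  ...   | no  _ = filter-filter xs

module _ {A : Set} {P Q : Pred A 0ℓ} (P? : Decidable P) (Q? : Decidable Q) where

  filter-comm : ∀ xs → filter P? (filter Q? xs) ≡ filter Q? (filter P? xs)
  filter-comm xs = begin
    filter P? (filter Q? xs)  ≡⟨ filter-filter P? Q? xs ⟩
    filter (Q? ∩? P?) xs      ≡⟨ filter-≐ (Q? ∩? P?) (P? ∩? Q?) (×-swap , ×-swap) xs ⟩
    filter (P? ∩? Q?) xs      ≡⟨ filter-filter Q? P? xs ⟨
    filter Q? (filter P? xs)  ∎
    where open ≡-Reasoning

module _ {A : Set} {Q : Pred (List A) 0ℓ} (Q? : Decidable Q) where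

  filter-sublists-∷ : ∀ x xs → filter Q? (sublists (x ∷ xs))
    ≡ map (x ∷_) (filter (Q? ∘ (x ∷_)) (sublists xs)) ++ filter Q? (sublists xs)
  filter-sublists-∷ x xs = trans (filter-++ Q? (map (x ∷_) (sublists xs)) (sublists xs))
                                 (cong (_++ filter Q? (sublists xs)) (filter-map Q? (x ∷_) (sublists xs)))

module _ {A : Set} {Q : Pred A 0ℓ} (Q? : Decidable Q) where

  filter-all-sublists : ∀ xs → filter (all? Q?) (sublists xs) ≡ sublists (filter Q? xs)
  filter-all-sublists []       = refl
  filter-all-sublists (x ∷ xs) with Q? x
  ... | yes qx = trans (filter-sublists-∷ (all? Q?) x xs) (cong₂ (λ ys zs → map (x ∷_) ys ++ zs)
    (trans (filter-≐ (all? Q? ∘ (x ∷_)) (all? Q?) ((λ where (_ ∷ qs) → qs) , (qx ∷_)) (sublists xs))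
           (filter-all-sublists xs))
    (filter-all-sublists xs))
  ... | no ¬qx = trans (filter-sublists-∷ (all? Q?) x xs) (cong₂ (λ ys zs → map (x ∷_) ys ++ zs)
    (filter-none (all? Q? ∘ (x ∷_)) (All.universal (λ _ → ¬qx ∘ All.head) (sublists xs)))
    (filter-all-sublists xs))

ofLength? : {A : Set} (l : ℕ) → Decidable (λ (s : List A) → length s ≡ l)
ofLength? l s = length s ≟ l

filter-ofLength-0-sublists : ∀ {A : Set} (xs : List A) → filter (ofLength? 0) (sublists xs) ≡ [ [] ]
filter-ofLength-0-sublists []       = refl
filter-ofLength-0-sublists (x ∷ xs) = trans (filter-sublists-∷ (ofLength? 0) x xs)
  (cong₂ (λ ys zs → map (x ∷_) ys ++ zs)
    (filter-none (ofLength? 0 ∘ (x ∷_)) (All.universal (λ _ ()) (sublists xs)))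
    (filter-ofLength-0-sublists xs))

module _ {A : Set} (f : A → ℕ) where

  distinct? : Decidable (AllPairs (λ p q → ¬ f p ≡ f q))
  distinct? = allPairs? (λ p q → ¬? (f p ≟ f q))

  countDistinctSublists : List A → ℕ → ℕ
  countDistinctSublists L l = length (filter distinct? (filter (ofLength? l) (sublists L)))

  multiplicity : List A → ℕ → ℕ
  multiplicity L v = length (filter (λ p → f p ≟ v) L)

  avoiding? : (x : A) → Decidable (λ p → ¬ f x ≡ f p)
  avoiding? x p = ¬? (f x ≟ f p)

  countDistinctSublists-zero : ∀ L → countDistinctSublists L 0 ≡ 1
  countDistinctSublists-zero L = cong (length ∘ filter distinct?) (filter-ofLength-0-sublists L)

  countDistinctSublists-containing : ∀ x L l →
    length (filter distinct? (map (x ∷_) (filter (ofLength? (suc l) ∘ (x ∷_)) (sublists L))))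
      ≡ countDistinctSublists (filter (avoiding? x) L) l
  countDistinctSublists-containing x L l = begin
    length (filter distinct? (map (x ∷_) (filter (ofLength? (suc l) ∘ (x ∷_)) S)))
      ≡⟨ cong length (filter-map distinct? (x ∷_) (filter (ofLength? (suc l) ∘ (x ∷_)) S)) ⟩
    length (map (x ∷_) (filter (distinct? ∘ (x ∷_)) (filter (ofLength? (suc l) ∘ (x ∷_)) S)))
      ≡⟨ length-map (x ∷_) (filter (distinct? ∘ (x ∷_)) (filter (ofLength? (suc l) ∘ (x ∷_)) S)) ⟩
    length (filter (distinct? ∘ (x ∷_)) (filter (ofLength? (suc l) ∘ (x ∷_)) S))
      ≡⟨ cong (length ∘ filter (distinct? ∘ (x ∷_)))
              (filter-≐ (ofLength? (suc l) ∘ (x ∷_)) (ofLength? l) (suc-injective , cong suc) S) ⟩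
    length (filter (distinct? ∘ (x ∷_)) (filter (ofLength? l) S))
      ≡⟨ cong length (filter-≐ (distinct? ∘ (x ∷_)) (all? (avoiding? x) ∩? distinct?)
                               ((λ where (h ∷ t) → h , t) , (λ where (h , t) → h ∷ t))
                               (filter (ofLength? l) S)) ⟩
    length (filter (all? (avoiding? x) ∩? distinct?) (filter (ofLength? l) S))
      ≡⟨ cong length (filter-filter distinct? (all? (avoiding? x)) (filter (ofLength? l) S)) ⟨
    length (filter distinct? (filter (all? (avoiding? x)) (filter (ofLength? l) S)))
      ≡⟨ cong (length ∘ filter distinct?) (filter-comm (all? (avoiding? x)) (ofLength? l) S) ⟩
    length (filter distinct? (filter (ofLength? l) (filter (all? (avoiding? x)) S)))
      ≡⟨ cong (length ∘ filter distinct? ∘ filter (ofLength? l)) (filter-all-sublists (avoiding? x) L) ⟩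
    countDistinctSublists (filter (avoiding? x) L) l ∎
    where
    open ≡-Reasoning
    S = sublists L

  countDistinctSublists-∷ : ∀ x L l → countDistinctSublists (x ∷ L) (suc l)
    ≡ countDistinctSublists (filter (avoiding? x) L) l + countDistinctSublists L (suc l)
  countDistinctSublists-∷ x L l = begin
    length (filter distinct? (filter (ofLength? (suc l)) (sublists (x ∷ L))))
      ≡⟨ cong (length ∘ filter distinct?) (filter-sublists-∷ (ofLength? (suc l)) x L) ⟩
    length (filter distinct? (containing ++ filter (ofLength? (suc l)) (sublists L)))
      ≡⟨ cong length (filter-++ distinct? containing (filter (ofLength? (suc l)) (sublists L))) ⟩
    length (filter distinct? containing ++ filter distinct? (filter (ofLength? (suc l)) (sublists L)))
      ≡⟨ length-++ (filter distinct? containing) ⟩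
    length (filter distinct? containing) + countDistinctSublists L (suc l)
      ≡⟨ cong (_+ countDistinctSublists L (suc l)) (countDistinctSublists-containing x L l) ⟩
    countDistinctSublists (filter (avoiding? x) L) l + countDistinctSublists L (suc l) ∎
    where
    open ≡-Reasoning
    containing = map (x ∷_) (filter (ofLength? (suc l) ∘ (x ∷_)) (sublists L))

  multiplicity-∷-self : ∀ x L → multiplicity (x ∷ L) (f x) ≡ suc (multiplicity L (f x))
  multiplicity-∷-self x L = cong length (filter-accept (λ p → f p ≟ f x) refl)

  multiplicity-∷-other : ∀ x L v → v ≢ f x → multiplicity (x ∷ L) v ≡ multiplicity L v
  multiplicity-∷-other x L v v≢fx = cong length (filter-reject (λ p → f p ≟ v) (v≢fx ∘ sym))

  multiplicity-avoiding-self : ∀ x L → multiplicity (filter (avoiding? x) L) (f x) ≡ 0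
  multiplicity-avoiding-self x L = cong length (trans
    (filter-filter (λ p → f p ≟ f x) (avoiding? x) L)
    (filter-none (avoiding? x ∩? (λ p → f p ≟ f x))
                 (All.universal (λ _ (fx≢fp , fp≡fx) → fx≢fp (sym fp≡fx)) L)))

  multiplicity-avoiding-other : ∀ x L v → v ≢ f x → multiplicity (filter (avoiding? x) L) v ≡ multiplicity L v
  multiplicity-avoiding-other x L v v≢fx = cong length (trans
    (filter-filter (λ p → f p ≟ v) (avoiding? x) L)
    (filter-≐ (avoiding? x ∩? (λ p → f p ≟ v)) (λ p → f p ≟ v)
      (proj₂ , λ fp≡v → (λ fx≡fp → v≢fx (trans (sym fp≡v) (sym fx≡fp))) , fp≡v) L))

  countDistinctSublists-esym : ∀ {B} l L → All (λ p → f p < B) L →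
    countDistinctSublists L l ≡ esym (applyUpTo (multiplicity L) B) l
  countDistinctSublists-esym zero L _ = countDistinctSublists-zero L
  countDistinctSublists-esym {B} (suc l) [] _ = sym (esym-zeros B l)
  countDistinctSublists-esym {B} (suc l) (x ∷ L) (fx<B ∷ L<B) = begin
    countDistinctSublists (x ∷ L) (suc l)
      ≡⟨ countDistinctSublists-∷ x L l ⟩
    countDistinctSublists (filter (avoiding? x) L) l + countDistinctSublists L (suc l)
      ≡⟨ cong₂ _+_ (countDistinctSublists-esym l (filter (avoiding? x) L) (filter⁺ (avoiding? x) L<B))
                   (countDistinctSublists-esym (suc l) L L<B) ⟩
    esym (applyUpTo (multiplicity (filter (avoiding? x) L)) B) l + esym (applyUpTo (multiplicity L) B) (suc l)
      ≡⟨ esym-applyUpTo-increment (multiplicity L) (multiplicity (x ∷ L))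
           (multiplicity (filter (avoiding? x) L)) fx<B
           (multiplicity-∷-self x L) (multiplicity-∷-other x L)
           (multiplicity-avoiding-self x L) (multiplicity-avoiding-other x L) l ⟨
    esym (applyUpTo (multiplicity (x ∷ L)) B) (suc l) ∎
    where open ≡-Reasoning

  multiplicity-++ : ∀ L M v → multiplicity (L ++ M) v ≡ multiplicity L v + multiplicity M v
  multiplicity-++ L M v =
    trans (cong length (filter-++ (λ p → f p ≟ v) L M)) (length-++ (filter (λ p → f p ≟ v) L))

  multiplicity-map : ∀ {C : Set} (g : C → A) L v →
    multiplicity (map g L) v ≡ length (filter (λ p → f (g p) ≟ v) L)
  multiplicity-map g L v =
    trans (cong length (filter-map (λ p → f p ≟ v) g L)) (length-map g (filter (λ p → f (g p) ≟ v) L))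
concatMap-upTo-suc : ∀ {A : Set} (F : ℕ → List A) m →
  concatMap F (upTo (suc m)) ≡ concatMap F (upTo m) ++ F m
concatMap-upTo-suc F m = begin
  concatMap F (upTo (suc m))        ≡⟨ cong (concatMap F) (upTo-∷ʳ m) ⟨
  concatMap F (upTo m ++ [ m ])     ≡⟨ concatMap-++ F (upTo m) [ m ] ⟩
  concatMap F (upTo m) ++ F m ++ [] ≡⟨ cong (concatMap F (upTo m) ++_) (++-identityʳ (F m)) ⟩
  concatMap F (upTo m) ++ F m       ∎
  where open ≡-Reasoning

multiplicity-upTo-≥ : ∀ {a m} → m ≤ a → multiplicity id (upTo m) a ≡ 0
multiplicity-upTo-≥ {a} {m} m≤a =
  cong length (filter-none (_≟ a) (applyUpTo⁺₁ id m (λ i<m → <⇒≢ (<-≤-trans i<m m≤a))))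

multiplicity-upTo-< : ∀ {a m} → a < m → multiplicity id (upTo m) a ≡ 1
multiplicity-upTo-< {a} {suc m} (s≤s a≤m) = begin
  multiplicity id (upTo (suc m)) a                     ≡⟨ cong (λ L → multiplicity id L a) (upTo-∷ʳ m) ⟨
  multiplicity id (upTo m ∷ʳ m) a                      ≡⟨ multiplicity-++ id (upTo m) [ m ] a ⟩
  multiplicity id (upTo m) a + multiplicity id [ m ] a ≡⟨ last-step (m ≟ a) ⟩
  1                                                    ∎
  where
  open ≡-Reasoning
  last-step : Dec (m ≡ a) → multiplicity id (upTo m) a + multiplicity id [ m ] a ≡ 1
  last-step (yes refl) = cong₂ _+_ (multiplicity-upTo-≥ {m} ≤-refl) (multiplicity-∷-self id m [])
  last-step (no m≢a)   = cong₂ _+_ (multiplicity-upTo-< (≤∧≢⇒< a≤m (m≢a ∘ sym)))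
                                   (multiplicity-∷-other id m [] a (m≢a ∘ sym))

∸-suc : ∀ {a m} → a < m → m ∸ a ≡ suc (m ∸ suc a)
∸-suc (s≤s a≤m) = +-∸-assoc 1 a≤m

∸-≥ : ∀ {a m} → m ≤ a → m ∸ a ≡ 0 × m ∸ suc a ≡ 0
∸-≥ m≤a = m≤n⇒m∸n≡0 m≤a , m≤n⇒m∸n≡0 (m≤n⇒m≤1+n m≤a)

row : ℕ → ℕ → List Point
row z y = map (λ x → (x , y , z)) (upTo y)

rows : ℕ → ℕ → List Point
rows z m = concatMap (row z) (upTo m)

-- S3 n unfolds to layers (suc n).
layers : ℕ → List Point
layers m = concatMap (λ z → rows z z) (upTo m)

module _ (f : Point → ℕ) where

  multiplicity-rows-suc : ∀ z m v →
    multiplicity f (rows z (suc m)) v ≡ multiplicity f (rows z m) v + multiplicity f (row z m) v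
  multiplicity-rows-suc z m v = trans (cong (λ L → multiplicity f L v) (concatMap-upTo-suc (row z) m))
                                      (multiplicity-++ f (rows z m) (row z m) v)

  multiplicity-layers-suc : ∀ m v →
    multiplicity f (layers (suc m)) v ≡ multiplicity f (layers m) v + multiplicity f (rows m m) v
  multiplicity-layers-suc m v =
    trans (cong (λ L → multiplicity f L v) (concatMap-upTo-suc (λ z → rows z z) m))
          (multiplicity-++ f (layers m) (rows m m) v)

multiplicity-rows-x : ∀ z m a → multiplicity xc (rows z m) a ≡ m ∸ suc a
multiplicity-rows-x z zero    a = refl
multiplicity-rows-x z (suc m) a = begin
  multiplicity xc (rows z (suc m)) a
    ≡⟨ multiplicity-rows-suc xc z m a ⟩
  multiplicity xc (rows z m) a + multiplicity xc (row z m) a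
    ≡⟨ cong₂ _+_ (multiplicity-rows-x z m a) (multiplicity-map xc (λ x → (x , m , z)) (upTo m) a) ⟩
  m ∸ suc a + multiplicity id (upTo m) a
    ≡⟨ new-row (a <? m) ⟩
  m ∸ a ∎
  where
  open ≡-Reasoning
  new-row : Dec (a < m) → m ∸ suc a + multiplicity id (upTo m) a ≡ m ∸ a
  new-row (yes a<m) rewrite multiplicity-upTo-< a<m | ∸-suc a<m = +-comm _ 1
  new-row (no a≮m) with ∸-≥ (≮⇒≥ a≮m)
  ... | m∸a≡0 , m∸1+a≡0 rewrite multiplicity-upTo-≥ (≮⇒≥ a≮m) | m∸a≡0 | m∸1+a≡0 = refl

multiplicity-layers-x : ∀ m a → multiplicity xc (layers m) a ≡ triangle (m ∸ suc a)
multiplicity-layers-x zero    a = refl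
multiplicity-layers-x (suc m) a = begin
  multiplicity xc (layers (suc m)) a
    ≡⟨ multiplicity-layers-suc xc m a ⟩
  multiplicity xc (layers m) a + multiplicity xc (rows m m) a
    ≡⟨ cong₂ _+_ (multiplicity-layers-x m a) (multiplicity-rows-x m m a) ⟩
  triangle (m ∸ suc a) + (m ∸ suc a)
    ≡⟨ new-layer (a <? m) ⟩
  triangle (m ∸ a) ∎
  where
  open ≡-Reasoning
  new-layer : Dec (a < m) → triangle (m ∸ suc a) + (m ∸ suc a) ≡ triangle (m ∸ a)
  new-layer (yes a<m) rewrite ∸-suc a<m = sym (triangle-suc (m ∸ suc a))
  new-layer (no a≮m) with ∸-≥ (≮⇒≥ a≮m)
  ... | m∸a≡0 , m∸1+a≡0 rewrite m∸a≡0 | m∸1+a≡0 = refl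

multiplicity-row-y-self : ∀ z y → multiplicity yc (row z y) y ≡ y
multiplicity-row-y-self z y = trans (multiplicity-map yc (λ x → (x , y , z)) (upTo y) y)
  (trans (cong length (filter-all (λ _ → y ≟ y) (All.universal (λ _ → refl) (upTo y))))
         (length-applyUpTo id y))

multiplicity-row-y-other : ∀ z y b → y ≢ b → multiplicity yc (row z y) b ≡ 0
multiplicity-row-y-other z y b y≢b = trans (multiplicity-map yc (λ x → (x , y , z)) (upTo y) b)
  (cong length (filter-none (λ _ → y ≟ b) (All.universal (λ _ → y≢b) (upTo y))))

multiplicity-rows-y-≥ : ∀ z m b → m ≤ b → multiplicity yc (rows z m) b ≡ 0
multiplicity-rows-y-≥ z zero    b _   = refl
multiplicity-rows-y-≥ z (suc m) b m<b = trans (multiplicity-rows-suc yc z m b)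
  (cong₂ _+_ (multiplicity-rows-y-≥ z m b (<⇒≤ m<b)) (multiplicity-row-y-other z m b (<⇒≢ m<b)))

multiplicity-rows-y-< : ∀ z m b → b < m → multiplicity yc (rows z m) b ≡ b
multiplicity-rows-y-< z (suc m) b (s≤s b≤m) = trans (multiplicity-rows-suc yc z m b) (new-row (b ≟ m))
  where
  new-row : Dec (b ≡ m) → multiplicity yc (rows z m) b + multiplicity yc (row z m) b ≡ b
  new-row (yes refl) = cong₂ _+_ (multiplicity-rows-y-≥ z b b ≤-refl) (multiplicity-row-y-self z b)
  new-row (no b≢m)   = trans (cong₂ _+_ (multiplicity-rows-y-< z m b (≤∧≢⇒< b≤m b≢m))
                                        (multiplicity-row-y-other z m b (b≢m ∘ sym)))
                             (+-identityʳ b)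

multiplicity-layers-y : ∀ m b → multiplicity yc (layers m) b ≡ b * (m ∸ suc b)
multiplicity-layers-y zero    b = sym (*-zeroʳ b)
multiplicity-layers-y (suc m) b = begin
  multiplicity yc (layers (suc m)) b
    ≡⟨ multiplicity-layers-suc yc m b ⟩
  multiplicity yc (layers m) b + multiplicity yc (rows m m) b
    ≡⟨ cong (_+ multiplicity yc (rows m m) b) (multiplicity-layers-y m b) ⟩
  b * (m ∸ suc b) + multiplicity yc (rows m m) b
    ≡⟨ new-layer (b <? m) ⟩
  b * (m ∸ b) ∎
  where
  open ≡-Reasoning
  new-layer : Dec (b < m) → b * (m ∸ suc b) + multiplicity yc (rows m m) b ≡ b * (m ∸ b)
  new-layer (yes b<m) rewrite multiplicity-rows-y-< m m b b<m | ∸-suc b<m =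
    trans (+-comm _ b) (sym (*-suc b (m ∸ suc b)))
  new-layer (no b≮m) with ∸-≥ (≮⇒≥ b≮m)
  ... | m∸b≡0 , m∸1+b≡0 rewrite multiplicity-rows-y-≥ m m b (≮⇒≥ b≮m) | m∸b≡0 | m∸1+b≡0 =
    +-identityʳ _

S3-bounded : ∀ (f : Point → ℕ) n → (∀ {x y z} → x < y → y < z → z ≤ n → f (x , y , z) ≤ n) →
  All (λ p → f p < suc n) (S3 n)
S3-bounded f n bound =
  concat⁺ (map⁺ {f = λ z → rows z z} (applyUpTo⁺₁ id (suc n) λ { {z} (s≤s z≤n′) →
    concat⁺ (map⁺ {f = row z} (applyUpTo⁺₁ id z λ {y} y<z →
      map⁺ {f = λ x → (x , y , z)} (applyUpTo⁺₁ id y λ x<y → s≤s (bound x<y y<z z≤n′)))) }))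

countDistinct-xc : ∀ n l → countDistinct xc n l ≡ esym (xCounts n) l
countDistinct-xc n l = trans
  (countDistinctSublists-esym xc l (S3 n)
    (S3-bounded xc n (λ x<y y<z z≤n → ≤-trans (<⇒≤ x<y) (≤-trans (<⇒≤ y<z) z≤n))))
  (cong (λ c → esym c l) (applyUpTo-cong (suc n) (λ a _ → multiplicity-layers-x (suc n) a)))

countDistinct-yc : ∀ n l → countDistinct yc n l ≡ esym (yCounts n) l
countDistinct-yc n l = trans
  (countDistinctSublists-esym yc l (S3 n) (S3-bounded yc n (λ _ y<z z≤n → ≤-trans (<⇒≤ y<z) z≤n)))
  (cong (λ c → esym c l) (applyUpTo-cong (suc n) (λ b _ → multiplicity-layers-y (suc n) b)))

theorem1 : (n l : ℕ) → 3 ≤ n → 2 ≤ l → l ≤ n ∸ 1 →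
    countDistinct xc n l < countDistinct yc n l
theorem1 n@(suc (suc (suc k))) l@(suc (suc j)) (s≤s (s≤s (s≤s _))) (s≤s (s≤s _)) (s≤s (s≤s j≤k)) =
  begin-strict
  countDistinct xc n l ≡⟨ countDistinct-xc n l ⟩
  esym (xCounts n) l   <⟨ esym-xCounts<esym-yCounts k j j≤k ⟩
  esym (yCounts n) l   ≡⟨ countDistinct-yc n l ⟨
  countDistinct yc n l ∎
  where open ≤-Reasoning
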